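{- For every integer $k\ge3$, the half-graph $B_k$ satisfies $\gamma^{\mathrm{FD}}(B_k)=2k-1$.
   Context: The half-graph $B_k$ is the bipartite graph with vertex set $\{u_1,\dots,u_k\}\cup\{w_1,\dots,w_k\}$ and edges $u_iw_j$ exactly when $i\le j$. For a vertex $v$, $N(v)$ is its open and $N[v]=N(v)\cup\{v\}$ its closed neighborhood. A vertex set $C$ is full-separating if for all distinct $u,v$, $(N(v)\cap C)\setminus\{u\}\neq(N(u)\cap C)\setminus\{v\}$, and dominating if $N[v]\cap C\neq\emptyset$ for all $v$. An FD-code is a full-separating dominating set; $\gamma^{\mathrm{FD}}$ is the minimum cardinality of an FD-code. -}

module Defs where

open import Data.Nat using (ℕ; _≤_; _+_)
open import Data.Fin using (Fin; splitAt; toℕ)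
open import Data.Fin.Subset using (Subset; _∈_; ∣_∣)
open import Data.Sum using (_⊎_; inj₁; inj₂)
open import Data.Product using (_×_; ∃-syntax)
open import Data.Empty using (⊥)
open import Relation.Nullary using (¬_)
open import Relation.Binary.PropositionalEquality using (_≡_)
open import Function.Bundles using (_⇔_)

Graph : ℕ → Set₁
Graph n = Fin n → Fin n → Set

SameTrace : ∀ {n} → Graph n → Subset n → Fin n → Fin n → Set
SameTrace {n} E C u v =
  (x : Fin n) → ((E v x × x ∈ C × ¬ x ≡ u) ⇔ (E u x × x ∈ C × ¬ x ≡ v))

FullSeparating : ∀ {n} → Graph n → Subset n → Set
FullSeparating {n} E C = (u v : Fin n) → ¬ u ≡ v → ¬ SameTrace E C u v

Dominating : ∀ {n} → Graph n → Subset n → Set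
Dominating {n} E C = (v : Fin n) → ∃[ x ] ((x ≡ v ⊎ E v x) × x ∈ C)

FDCode : ∀ {n} → Graph n → Subset n → Set
FDCode E C = FullSeparating E C × Dominating E C

GammaFD≡ : ∀ {n} → Graph n → ℕ → Set
GammaFD≡ {n} E m =
  (∃[ C ] (FDCode E C × ∣ C ∣ ≡ m)) × ((C : Subset n) → FDCode E C → m ≤ ∣ C ∣)

-- Half-graph B_k on Fin (k + k): vertex i (i < k, via splitAt) is u_{i+1},
-- vertex k + j is w_{j+1}; u_i w_j is an edge iff i ≤ j.
HalfAdj : (k : ℕ) → Fin k ⊎ Fin k → Fin k ⊎ Fin k → Set
HalfAdj k (inj₁ i) (inj₂ j) = toℕ i ≤ toℕ j
HalfAdj k (inj₂ j) (inj₁ i) = toℕ i ≤ toℕ j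
HalfAdj k (inj₁ _) (inj₁ _) = ⊥
HalfAdj k (inj₂ _) (inj₂ _) = ⊥

HalfGraph : (k : ℕ) → Graph (k + k)
HalfGraph k x y = HalfAdj k (splitAt k x) (splitAt k y)

-- Whenever the neighbourhoods of two distinct vertices u, v agree
-- outside a set X, the traces of u and v on a full-separating code C can only
-- differ if C meets X. In B_k the neighbourhoods of w_i and w_{i+1} differ only
-- in u_{i+1}, those of u_i and u_{i+1} only in w_i, and those of u_k and w_1 lie
-- inside {u_1, w_k}. Hence every FD-code contains every vertex other than u_1
-- and w_k, and at least one of these two, so it has at least 2k - 1 elements.
-- Conversely, for k ≥ 3 all vertices but w_k form an FD-code.
module Submission where

open import Defs
open import Data.Nat using (ℕ; zero; suc; _≤_; _<_; _+_; _∸_; z≤n; s≤s)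
open import Data.Nat.Properties
  using (≤-refl; ≤-antisym; m≤n⇒m≤1+n; <⇒≤; <⇒≤pred; <⇒≱; ≤∧≢⇒<; <-cmp; <⇒≢; n<1+n)
open import Data.Fin using (Fin; zero; suc; toℕ; fromℕ; inject₁; lower₁; join; splitAt; _≟_)
open import Data.Fin.Properties
  using (toℕ-injective; toℕ-fromℕ; toℕ-inject₁; toℕ≤pred[n]; inject₁-lower₁; splitAt-join; join-splitAt)
open import Data.Fin.Subset using (Subset; _∈_; ∣_∣; ∁; ⁅_⁆)
open import Data.Fin.Subset.Properties
  using (_∈?_; x≢y⇒x∉⁅y⁆; x∉⁅y⁆⇒x≢y; ∣⁅x⁆∣≡1; ∣∁p∣≡n∸∣p∣; p⊆q⇒∣p∣≤∣q∣; x∈∁p⇒x∉p; x∉p⇒x∈∁p)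
open import Data.Sum using (_⊎_; inj₁; inj₂; [_,_]′; swap)
open import Data.Sum.Properties using (inj₁-injective; inj₂-injective)
open import Data.Product using (_×_; _,_; proj₁; ∃-syntax)
open import Function using (id; _∘_)
open import Function.Bundles using (_⇔_; mk⇔; Equivalence)
open import Function.Properties.Equivalence using () renaming (sym to ⇔-sym)
open import Relation.Nullary using (¬_; yes; no; contradiction)
open import Relation.Binary.Definitions using (Irreflexive; tri<; tri≈; tri>)
open import Relation.Binary.PropositionalEquality
  using (_≡_; _≢_; refl; sym; trans; cong; cong₂; subst; subst₂)

open Equivalence using (to; from)

≤⇔≤suc : ∀ {a b} → a ≢ suc b → a ≤ b ⇔ a ≤ suc b
≤⇔≤suc a≢1+b = mk⇔ m≤n⇒m≤1+n (λ a≤1+b → <⇒≤pred (≤∧≢⇒< a≤1+b a≢1+b))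

≤⇔< : ∀ {a b} → a ≢ b → a ≤ b ⇔ a < b
≤⇔< a≢b = mk⇔ (λ a≤b → ≤∧≢⇒< a≤b a≢b) <⇒≤

toℕ-fromℕ≤⇒≡fromℕ : ∀ {m} (d : Fin (suc m)) → toℕ (fromℕ m) ≤ toℕ d → d ≡ fromℕ m
toℕ-fromℕ≤⇒≡fromℕ {m} d m≤d =
  toℕ-injective (trans (≤-antisym (toℕ≤pred[n] d) (subst (_≤ toℕ d) (toℕ-fromℕ m) m≤d))
                       (sym (toℕ-fromℕ m)))

inject₁≢suc : ∀ {m} (i : Fin m) → inject₁ i ≢ suc i
inject₁≢suc i eq = <⇒≢ (n<1+n (toℕ i)) (trans (sym (toℕ-inject₁ i)) (cong toℕ eq))

module _ {n : ℕ} where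

  ∈∁⁅⁆ : ∀ {x y : Fin n} → y ≢ x → y ∈ ∁ ⁅ x ⁆
  ∈∁⁅⁆ = x∉p⇒x∈∁p ∘ x≢y⇒x∉⁅y⁆

  ∣∁⁅x⁆∣≡n∸1 : (x : Fin n) → ∣ ∁ ⁅ x ⁆ ∣ ≡ n ∸ 1
  ∣∁⁅x⁆∣≡n∸1 x = trans (∣∁p∣≡n∸∣p∣ ⁅ x ⁆) (cong (n ∸_) (∣⁅x⁆∣≡1 x))

  ∣C∣≥n∸1 : ∀ {C : Subset n} x → (∀ y → y ≢ x → y ∈ C) → n ∸ 1 ≤ ∣ C ∣
  ∣C∣≥n∸1 {C} x contains =
    subst (_≤ ∣ C ∣) (∣∁⁅x⁆∣≡n∸1 x) (p⊆q⇒∣p∣≤∣q∣ (λ y∈ → contains _ (x∉⁅y⁆⇒x≢y (x∈∁p⇒x∉p y∈))))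

  contains-all-but : ∀ {C : Subset n} {a b} → (∀ y → y ≢ a → y ≢ b → y ∈ C) → a ∈ C → ∀ y → y ≢ b → y ∈ C
  contains-all-but {a = a} contains a∈C y y≢b with y ≟ a
  ... | yes refl = a∈C
  ... | no y≢a = contains y y≢a y≢b

  ∣C∣≥n∸1-of-pair : ∀ {C : Subset n} {a b} → (∀ y → y ≢ a → y ≢ b → y ∈ C) → a ∈ C ⊎ b ∈ C →
    n ∸ 1 ≤ ∣ C ∣
  ∣C∣≥n∸1-of-pair contains (inj₁ a∈C) = ∣C∣≥n∸1 _ (contains-all-but contains a∈C)
  ∣C∣≥n∸1-of-pair contains (inj₂ b∈C) =
    ∣C∣≥n∸1 _ (contains-all-but (λ y y≢b y≢a → contains y y≢a y≢b) b∈C)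

module _ {n : ℕ} {E : Graph n} where

  SameTrace-sym : ∀ {C u v} → SameTrace E C u v → SameTrace E C v u
  SameTrace-sym st x = ⇔-sym (st x)

  agreement⇒SameTrace : Irreflexive _≡_ E → ∀ {C u v} → (∀ x → x ∈ C → E u x ⇔ E v x) → SameTrace E C u v
  agreement⇒SameTrace irr agree x = mk⇔
    (λ (e , x∈C , _) → from (agree x x∈C) e , x∈C , λ x≡v → irr (sym x≡v) e)
    (λ (e , x∈C , _) → to (agree x x∈C) e , x∈C , λ x≡u → irr (sym x≡u) e)

  fullSeparating-meets : ∀ {C} → FullSeparating E C → Irreflexive _≡_ E → ∀ {u v x₁ x₂} → u ≢ v →
    (∀ y → y ≢ x₁ → y ≢ x₂ → E u y ⇔ E v y) → x₁ ∈ C ⊎ x₂ ∈ C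
  fullSeparating-meets {C} fs irr {x₁ = x₁} {x₂} u≢v agree with x₁ ∈? C | x₂ ∈? C
  ... | yes x₁∈C | _ = inj₁ x₁∈C
  ... | no _ | yes x₂∈C = inj₂ x₂∈C
  ... | no x₁∉C | no x₂∉C = contradiction (agreement⇒SameTrace irr agreeOnC) (fs _ _ u≢v)
    where
    agreeOnC : ∀ y → y ∈ C → _
    agreeOnC y y∈C = agree y (λ { refl → x₁∉C y∈C }) (λ { refl → x₂∉C y∈C })

  witness⇒¬SameTrace : ∀ {C u v x} → x ∈ C → x ≢ v → E u x → ¬ E v x → ¬ SameTrace E C u v
  witness⇒¬SameTrace x∈C x≢v eᵤ ¬eᵥ st = ¬eᵥ (proj₁ (from (st _) (eᵤ , x∈C , x≢v)))

  ∁⁅x⁆-dominating : Irreflexive _≡_ E → ∀ {x z} → E x z → Dominating E (∁ ⁅ x ⁆)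
  ∁⁅x⁆-dominating irr {x} {z} e v with v ≟ x
  ... | yes refl = z , inj₂ e , ∈∁⁅⁆ (λ { refl → irr refl e })
  ... | no v≢x = v , inj₁ refl , ∈∁⁅⁆ v≢x

-- join k k identifies Fin k ⊎ Fin k with the vertices of HalfGraph k; on that
-- side HalfAdj k computes by pattern matching.
module _ {k : ℕ} where

  halfAdj-irreflexive : ∀ s → ¬ HalfAdj k s s
  halfAdj-irreflexive (inj₁ _) ()
  halfAdj-irreflexive (inj₂ _) ()

  halfGraph-irreflexive : Irreflexive _≡_ (HalfGraph k)
  halfGraph-irreflexive {x} refl = halfAdj-irreflexive (splitAt k x)

  halfGraph-join : ∀ p y → HalfGraph k (join k k p) y ≡ HalfAdj k p (splitAt k y)
  halfGraph-join p y = cong (λ q → HalfAdj k q (splitAt k y)) (splitAt-join k k p)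

  halfGraph-join₂ : ∀ p q → HalfGraph k (join k k p) (join k k q) ≡ HalfAdj k p q
  halfGraph-join₂ p q = cong₂ (HalfAdj k) (splitAt-join k k p) (splitAt-join k k q)

  join-≢ : ∀ {p q} → p ≢ q → join k k p ≢ join k k q
  join-≢ {p} {q} p≢q eq =
    p≢q (trans (sym (splitAt-join k k p)) (trans (cong (splitAt k) eq) (splitAt-join k k q)))

  splitAt-≢ : ∀ {y t} → y ≢ join k k t → splitAt k y ≢ t
  splitAt-≢ {y} y≢t refl = y≢t (sym (join-splitAt k k y))

  halfGraph-agreement : ∀ {p q t₁ t₂} → (∀ s → s ≢ t₁ → s ≢ t₂ → HalfAdj k p s ⇔ HalfAdj k q s) →
    ∀ y → y ≢ join k k t₁ → y ≢ join k k t₂ → HalfGraph k (join k k p) y ⇔ HalfGraph k (join k k q) y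
  halfGraph-agreement {p} {q} agree y y≢t₁ y≢t₂ =
    subst₂ _⇔_ (sym (halfGraph-join p y)) (sym (halfGraph-join q y))
      (agree (splitAt k y) (splitAt-≢ y≢t₁) (splitAt-≢ y≢t₂))

  fullSeparating-via-join : ∀ {C} → (∀ p q → p ≢ q → ¬ SameTrace (HalfGraph k) C (join k k p) (join k k q)) →
    FullSeparating (HalfGraph k) C
  fullSeparating-via-join {C} sep u v u≢v =
    subst₂ (λ u v → ¬ SameTrace (HalfGraph k) C u v) (join-splitAt k k u) (join-splitAt k k v)
      (sep (splitAt k u) (splitAt k v) (splitAt-≢ λ u≡v → u≢v (trans u≡v (join-splitAt k k v))))

module _ {m : ℕ} where

  w-step-agreement : (i : Fin m) → ∀ s → s ≢ inj₁ (suc i) →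
    HalfAdj (suc m) (inj₂ (inject₁ i)) s ⇔ HalfAdj (suc m) (inj₂ (suc i)) s
  w-step-agreement i (inj₁ c) c≢1+i =
    subst (λ t → toℕ c ≤ t ⇔ toℕ c ≤ suc (toℕ i)) (sym (toℕ-inject₁ i))
      (≤⇔≤suc (λ eq → c≢1+i (cong inj₁ (toℕ-injective eq))))
  w-step-agreement i (inj₂ _) _ = mk⇔ (λ ()) (λ ())

  u-step-agreement : (i : Fin m) → ∀ s → s ≢ inj₂ (inject₁ i) →
    HalfAdj (suc m) (inj₁ (inject₁ i)) s ⇔ HalfAdj (suc m) (inj₁ (suc i)) s
  u-step-agreement i (inj₁ _) _ = mk⇔ (λ ()) (λ ())
  u-step-agreement i (inj₂ d) d≢i =
    subst (λ t → t ≤ toℕ d ⇔ toℕ i < toℕ d) (sym (toℕ-inject₁ i))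
      (≤⇔< (λ eq → d≢i (cong inj₂ (toℕ-injective (trans (sym eq) (sym (toℕ-inject₁ i)))))))

  ends-agreement : ∀ s → s ≢ inj₁ zero → s ≢ inj₂ (fromℕ m) →
    HalfAdj (suc m) (inj₁ (fromℕ m)) s ⇔ HalfAdj (suc m) (inj₂ zero) s
  ends-agreement (inj₁ zero) s≢u₁ _ = contradiction refl s≢u₁
  ends-agreement (inj₁ (suc _)) _ _ = mk⇔ (λ ()) (λ ())
  ends-agreement (inj₂ d) _ s≢wₖ =
    mk⇔ (λ m≤d → contradiction (cong inj₂ (toℕ-fromℕ≤⇒≡fromℕ d m≤d)) s≢wₖ) (λ ())

module LowerBound {m : ℕ} {C : Subset (suc m + suc m)} (fs : FullSeparating (HalfGraph (suc m)) C) where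

  private
    vertex : Fin (suc m) ⊎ Fin (suc m) → Fin (suc m + suc m)
    vertex = join (suc m) (suc m)

  meets : ∀ {p q t₁ t₂} → p ≢ q → (∀ s → s ≢ t₁ → s ≢ t₂ → HalfAdj (suc m) p s ⇔ HalfAdj (suc m) q s) →
    vertex t₁ ∈ C ⊎ vertex t₂ ∈ C
  meets p≢q agree = fullSeparating-meets fs halfGraph-irreflexive (join-≢ p≢q) (halfGraph-agreement agree)

  contains : ∀ {p q t} → p ≢ q → (∀ s → s ≢ t → HalfAdj (suc m) p s ⇔ HalfAdj (suc m) q s) → vertex t ∈ C
  contains {t = t} p≢q agree = [ id , id ]′ (meets {t₁ = t} {t₂ = t} p≢q λ s s≢t _ → agree s s≢t)

  contains-inner : ∀ s → s ≢ inj₁ zero → s ≢ inj₂ (fromℕ m) → vertex s ∈ C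
  contains-inner (inj₁ zero) s≢u₁ _ = contradiction refl s≢u₁
  contains-inner (inj₁ (suc i)) _ _ = contains (inject₁≢suc i ∘ inj₂-injective) (w-step-agreement i)
  contains-inner (inj₂ j) _ s≢wₖ =
    subst (λ j → vertex (inj₂ j) ∈ C) (inject₁-lower₁ j m≢j)
      (contains (inject₁≢suc _ ∘ inj₁-injective) (u-step-agreement (lower₁ j m≢j)))
    where
    m≢j : m ≢ toℕ j
    m≢j eq = s≢wₖ (cong inj₂ (toℕ-injective (trans (sym eq) (sym (toℕ-fromℕ m)))))

  lower-bound : (suc m + suc m) ∸ 1 ≤ ∣ C ∣
  lower-bound = ∣C∣≥n∸1-of-pair contains-all-but-ends (meets (λ ()) ends-agreement)
    where
    contains-all-but-ends : ∀ y → y ≢ vertex (inj₁ zero) → y ≢ vertex (inj₂ (fromℕ m)) → y ∈ C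
    contains-all-but-ends y y≢u₁ y≢wₖ =
      subst (_∈ C) (join-splitAt (suc m) (suc m) y)
        (contains-inner (splitAt (suc m) y) (splitAt-≢ y≢u₁) (splitAt-≢ y≢wₖ))

module UpperBound (n : ℕ) where

  private
    k : ℕ
    k = suc (suc (suc n))

    Vertex : Set
    Vertex = Fin k ⊎ Fin k

    wₖ : Vertex
    wₖ = inj₂ (fromℕ (suc (suc n)))

  Separates : (p q s : Vertex) → Set
  Separates p q s = s ≢ q × HalfAdj k p s × ¬ HalfAdj k q s

  Separated : (p q : Vertex) → Set
  Separated p q = ∃[ s ] (s ≢ wₖ × (Separates p q s ⊎ Separates q p s))

  separated-sym : ∀ {p q} → Separated p q → Separated q p
  separated-sym (s , s≢wₖ , sep) = s , s≢wₖ , swap sep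

  u-separated : ∀ {a b} → toℕ a < toℕ b → Separated (inj₁ a) (inj₁ b)
  u-separated {a} {b} a<b = inj₂ a , a≢wₖ , inj₁ ((λ ()) , ≤-refl , <⇒≱ a<b)
    where
    a≢wₖ : inj₂ a ≢ wₖ
    a≢wₖ refl = <⇒≱ a<b (subst (toℕ b ≤_) (sym (toℕ-fromℕ _)) (toℕ≤pred[n] b))

  w-separated : ∀ {a b} → toℕ a < toℕ b → Separated (inj₂ a) (inj₂ b)
  w-separated a<b = inj₁ _ , (λ ()) , inj₂ ((λ ()) , ≤-refl , <⇒≱ a<b)

  uw-separated : ∀ a b → Separated (inj₁ a) (inj₂ b)
  uw-separated (suc a) b = inj₁ zero , (λ ()) , inj₂ ((λ ()) , z≤n , λ ())
  uw-separated zero (suc b) = inj₁ (suc b) , (λ ()) , inj₂ ((λ ()) , ≤-refl , λ ())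
  uw-separated zero zero = inj₂ (suc zero) , (λ ()) , inj₁ ((λ ()) , z≤n , λ ())

  separated : ∀ p q → p ≢ q → Separated p q
  separated (inj₁ a) (inj₁ b) p≢q with <-cmp (toℕ a) (toℕ b)
  ... | tri< a<b _ _ = u-separated a<b
  ... | tri≈ _ a≡b _ = contradiction (cong inj₁ (toℕ-injective a≡b)) p≢q
  ... | tri> _ _ b<a = separated-sym (u-separated b<a)
  separated (inj₂ a) (inj₂ b) p≢q with <-cmp (toℕ a) (toℕ b)
  ... | tri< a<b _ _ = w-separated a<b
  ... | tri≈ _ a≡b _ = contradiction (cong inj₂ (toℕ-injective a≡b)) p≢q
  ... | tri> _ _ b<a = separated-sym (w-separated b<a)
  separated (inj₁ a) (inj₂ b) _ = uw-separated a b
  separated (inj₂ b) (inj₁ a) _ = separated-sym (uw-separated a b)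

  C₀ : Subset (k + k)
  C₀ = ∁ ⁅ join k k wₖ ⁆

  separates⇒¬SameTrace : ∀ {p q s} → s ≢ wₖ → Separates p q s →
    ¬ SameTrace (HalfGraph k) C₀ (join k k p) (join k k q)
  separates⇒¬SameTrace {p} {q} {s} s≢wₖ (s≢q , adj , ¬adj) =
    witness⇒¬SameTrace {E = HalfGraph k} (∈∁⁅⁆ (join-≢ s≢wₖ)) (join-≢ s≢q)
      (subst id (sym (halfGraph-join₂ p s)) adj) (¬adj ∘ subst id (halfGraph-join₂ q s))

  separated⇒¬SameTrace : ∀ {p q} → Separated p q → ¬ SameTrace (HalfGraph k) C₀ (join k k p) (join k k q)
  separated⇒¬SameTrace (_ , s≢wₖ , inj₁ sep) = separates⇒¬SameTrace s≢wₖ sep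
  separated⇒¬SameTrace (_ , s≢wₖ , inj₂ sep) =
    separates⇒¬SameTrace s≢wₖ sep ∘ SameTrace-sym {E = HalfGraph k}

  fullSeparating-C₀ : FullSeparating (HalfGraph k) C₀
  fullSeparating-C₀ = fullSeparating-via-join λ p q → separated⇒¬SameTrace ∘ separated p q

  dominating-C₀ : Dominating (HalfGraph k) C₀
  dominating-C₀ = ∁⁅x⁆-dominating {E = HalfGraph k} halfGraph-irreflexive {join k k wₖ} {join k k (inj₁ zero)}
    (subst id (sym (halfGraph-join₂ wₖ (inj₁ zero))) z≤n)

  ∣C₀∣ : ∣ C₀ ∣ ≡ (k + k) ∸ 1
  ∣C₀∣ = ∣∁⁅x⁆∣≡n∸1 (join k k wₖ)

theorem7 : (k : ℕ) → 3 ≤ k → GammaFD≡ (HalfGraph k) ((k + k) ∸ 1)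
theorem7 (suc (suc (suc n))) _ =
  (C₀ , (fullSeparating-C₀ , dominating-C₀) , ∣C₀∣) , λ C (fs , _) → LowerBound.lower-bound fs
  where open UpperBound n
theorem7 (suc (suc zero)) (s≤s (s≤s ()))
theorem7 (suc zero) (s≤s ())
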